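{- Let $G=(V,E)$ be a finite simple bipartite graph with bipartition $V_1,V_2$, and let $G'=(V',E')$ be obtained from $G$ by adding a new vertex $v_1$ adjacent to every vertex of $V_1$, and a new vertex $v_0$ adjacent only to $v_1$. Let $(R,\sigma)$ be an assignment for $(G',v_0)$. Then: (1) if $\sigma(v_0)\neq\perp$, Player 1 has a winning strategy in the game $\mathcal{G}(G',v_0)$; (2) if $\sigma(v_0)=\perp$, Player 2 has a winning strategy in the game $\mathcal{G}(G',v_0)$.
   Context: $N_{G'}(v)$ denotes the set of neighbours of $v$ in $G'$. An assignment for $(G',v_0)$ is a pair $(R,\sigma)$ with $R\subseteq V'$, $v_0\in R$, and $\sigma:V'\to V'\cup\{\perp\}$ ($\perp$ a symbol not in $V'$) such that: (C1) for $v\in R$, if $\sigma(v)=u\in V'$ then $u\in N_{G'}(v)\cap R$ and $\sigma(u)=\perp$; (C2) for $v\in R$, if $\sigma(v)=\perp$ then for every $u\in N_{G'}(v)$ we have $u\in R$ and $\sigma(u)\neq\perp$; (C3) for $v\in R$ we have $|\sigma^{ -1}(v)|\le 1$, and $\sigma^{ -1}(v_0)=\emptyset$. The game $\mathcal{G}(G',v_0)$ is the two-player game whose positions are paths $P=p_0p_1\ldots p_k$ in $G'$ (sequences of pairwise distinct vertices with consecutive ones adjacent) with $p_0=v_0$. It starts with $P=v_0$. At position $P=p_0\ldots p_k$ the player to move is Player 1 if $k$ is even and Player 2 if $k$ is odd; that player must choose a vertex $v\in V'\setminus\{p_0,\ldots,p_k\}$ with $p_kv\in E'$ and append it to $P$.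 A player who has no such vertex available loses. A winning strategy for a player is a rule choosing his moves that guarantees he wins whatever the opponent plays. -}

module Defs where

open import Data.Nat using (ℕ)
open import Data.Fin using (Fin)
open import Data.Bool using (Bool; true; false)
open import Data.Maybe using (Maybe; just; nothing)
open import Data.List using (List; []; _∷_)
open import Data.List.Membership.Propositional using (_∉_)
open import Data.Unit using (⊤)
open import Data.Empty using (⊥)
open import Data.Product using (Σ; _×_)
open import Relation.Binary.PropositionalEquality using (_≡_; _≢_)

IsSimple : {n : ℕ} → (Fin n → Fin n → Bool) → Set
IsSimple adj = (∀ a b → adj a b ≡ true → adj b a ≡ true) × (∀ a → adj a a ≡ false)

-- A bipartition V₁ , V₂ of Fin n is given by side : Fin n → Bool,
-- with V₁ = { a | side a ≡ true } and V₂ = { a | side a ≡ false }.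
-- It is a bipartition of G if every edge joins V₁ and V₂.
IsBipartition : {n : ℕ} → (Fin n → Fin n → Bool) → (Fin n → Bool) → Set
IsBipartition adj side = ∀ a b → adj a b ≡ true → side a ≢ side b

data Vert (n : ℕ) : Set where
  old : Fin n → Vert n
  v₁  : Vert n
  v₀  : Vert n

Edge' : {n : ℕ} → (Fin n → Fin n → Bool) → (Fin n → Bool) → Vert n → Vert n → Set
Edge' adj side (old a) (old b) = adj a b ≡ true
Edge' adj side (old a) v₁      = side a ≡ true
Edge' adj side v₁      (old a) = side a ≡ true
Edge' adj side v₁      v₀      = ⊤
Edge' adj side v₀      v₁      = ⊤
Edge' adj side _       _       = ⊥

-- R is a subset of V' (as a Boolean
-- predicate), σ : V' → V' ∪ {⊥} is modelled as Vert n → Maybe (Vert n),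
-- with nothing playing the role of ⊥.  u ∈ N_{G'}(v) means Edge' v u.
record IsAssignment {n : ℕ} (adj : Fin n → Fin n → Bool) (side : Fin n → Bool)
                    (R : Vert n → Bool) (σ : Vert n → Maybe (Vert n)) : Set where
  field
    v₀∈R : R v₀ ≡ true
    C1   : ∀ v u → R v ≡ true → σ v ≡ just u →
             Edge' adj side v u × R u ≡ true × σ u ≡ nothing
    C2   : ∀ v → R v ≡ true → σ v ≡ nothing →
             ∀ u → Edge' adj side v u → R u ≡ true × σ u ≢ nothing
    C3   : ∀ v → R v ≡ true → ∀ u w → σ u ≡ just v → σ w ≡ just v → u ≡ w
    C3₀  : ∀ u → σ u ≢ just v₀

-- The game G(G', v₀).  A position P = p₀ p₁ … p_k is represented by the
-- list p_k ∷ … ∷ p₁ ∷ p₀ ∷ [] (most recent vertex first).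
data Player : Set where
  player1 player2 : Player

other : Player → Player
other player1 = player2
other player2 = player1

-- Player to move: Player 1 if k is even (list length k+1 odd), else Player 2.
toMove : {A : Set} → List A → Player
toMove []       = player2
toMove (_ ∷ xs) = other (toMove xs)

LegalMove : {n : ℕ} → (Fin n → Fin n → Bool) → (Fin n → Bool) →
            List (Vert n) → Vert n → Set
LegalMove adj side []      v = ⊥
LegalMove adj side (p ∷ P) v = Edge' adj side p v × v ∉ (p ∷ P)

Strategy : ℕ → Set
Strategy n = List (Vert n) → Vert n

-- At i's turn, s must prescribe
-- a legal move (if i has no legal move, i loses: no constructor applies);
-- at the opponent's turn, every legal opponent move must lead to a win
-- (in particular if the opponent has no legal move, i wins).
data Wins {n : ℕ} (adj : Fin n → Fin n → Bool) (side : Fin n → Bool)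
          (i : Player) (s : Strategy n) : List (Vert n) → Set where
  myTurn  : ∀ {P} → toMove P ≡ i → LegalMove adj side P (s P) →
            Wins adj side i s (s P ∷ P) → Wins adj side i s P
  oppTurn : ∀ {P} → toMove P ≡ other i →
            (∀ v → LegalMove adj side P v → Wins adj side i s (v ∷ P)) →
            Wins adj side i s P

HasWinningStrategy : {n : ℕ} → (Fin n → Fin n → Bool) → (Fin n → Bool) → Player → Set
HasWinningStrategy {n} adj side i =
  Σ (Strategy n) (λ s → Wins adj side i s (v₀ ∷ []))

-- The player who follows σ wins: whenever the opponent enters a vertex w,
-- answer with σ w.  Let the "unmatched" vertices be those v with σ v = ⊥.
-- We keep the invariant that the last vertex is an unmatched vertex of R
-- and that every unmatched vertex on the path other than v₀ is σ of an
-- earlier vertex of the path.  By (C2) the opponent's move w lies in R and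
-- is matched, so by (C1) the reply u = σ w is an unmatched vertex of R
-- adjacent to w; it is not yet on the path, because u ≠ w, u ≠ v₀ by (C3),
-- and otherwise u = σ y for some y on the path, forcing y = w by (C3).
-- Player 1 starts by moving to σ v₀ when σ v₀ ≠ ⊥; if σ v₀ = ⊥, Player 2
-- is already in this situation.  The game ends since paths cannot repeat
-- vertices, and the responder never gets stuck, so the opponent loses.
module Submission where

open import Defs
open import Data.Nat using (ℕ; _<_)
open import Data.Nat.Properties using (≤∧≢⇒<; <-trans)
open import Data.Nat.Induction using (<-wellFounded)
open import Induction.WellFounded using (Acc; acc)
open import Data.Fin using (Fin)
import Data.Fin.Properties as Fin
open import Data.Bool using (Bool; true)
open import Data.Maybe using (Maybe; just; nothing; fromMaybe)
open import Data.Product using (_×_; _,_; proj₂; ∃-syntax)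
open import Data.Sum using (_⊎_; inj₁; inj₂)
import Data.Sum as Sum
open import Data.Empty using (⊥-elim)
open import Data.List using (List; []; _∷_; map; filter; length; allFin)
open import Data.List.Relation.Unary.Any using (here; there)
open import Data.List.Membership.Propositional using (_∈_; _∉_)
open import Data.List.Membership.Propositional.Properties
  using (∈-map⁺; ∈-allFin; ∈-filter⁺; ∈-filter⁻)
import Data.List.Membership.DecPropositional as DecMembership
open import Data.List.Relation.Binary.Sublist.Propositional using (_⊆_; ⊆-refl)
open import Data.List.Relation.Binary.Sublist.Propositional.Properties
  using (length-mono-≤; to-≋; filter⁺)
open import Data.List.Relation.Binary.Pointwise using (Pointwise-≡⇒≡)
open import Relation.Nullary using (yes; no)
open import Relation.Nullary.Decidable using (map′)
open import Relation.Binary.Definitions using (DecidableEquality)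
open import Relation.Binary.PropositionalEquality
  using (_≡_; _≢_; refl; sym; trans; cong; subst)

⊆∧∉⇒length< : {A : Set} {as bs : List A} {v : A} →
              as ⊆ bs → v ∈ bs → v ∉ as → length as < length bs
⊆∧∉⇒length< as⊆bs v∈bs v∉as = ≤∧≢⇒< (length-mono-≤ as⊆bs) λ |as|≡|bs| →
  v∉as (subst (_ ∈_) (sym (Pointwise-≡⇒≡ (to-≋ |as|≡|bs| as⊆bs))) v∈bs)

module Unvisited {A : Set} (_≟_ : DecidableEquality A) (universe : List A) where
  open DecMembership _≟_ using (_∉?_)

  unvisited : List A → List A
  unvisited P = filter (_∉? P) universe

  unvisited-∷-< : ∀ {v P} → v ∈ universe → v ∉ P →
                  length (unvisited (v ∷ P)) < length (unvisited P)
  unvisited-∷-< {v} {P} v∈U v∉P = ⊆∧∉⇒length<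
    (filter⁺ (_∉? (v ∷ P)) (_∉? P) (λ { refl x∉v∷P x∈P → x∉v∷P (there x∈P) })
             (⊆-refl {x = universe}))
    (∈-filter⁺ (_∉? P) v∈U v∉P)
    (λ v∈ → proj₂ (∈-filter⁻ (_∉? (v ∷ P)) {xs = universe} v∈) (here refl))

≢nothing⇒just : {A : Set} {m : Maybe A} → m ≢ nothing → ∃[ a ] m ≡ just a
≢nothing⇒just {m = just a}  _        = a , refl
≢nothing⇒just {m = nothing} m≢nothing = ⊥-elim (m≢nothing refl)

other-involutive : ∀ i → other (other i) ≡ i
other-involutive player1 = refl
other-involutive player2 = refl

old-injective : ∀ {n} {a b : Fin n} → old a ≡ old b → a ≡ b
old-injective refl = refl

_≟_ : ∀ {n} → DecidableEquality (Vert n)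
old a ≟ old b = map′ (cong old) old-injective (a Fin.≟ b)
v₁    ≟ v₁    = yes refl
v₀    ≟ v₀    = yes refl
old _ ≟ v₁    = no λ ()
old _ ≟ v₀    = no λ ()
v₁    ≟ old _ = no λ ()
v₁    ≟ v₀    = no λ ()
v₀    ≟ old _ = no λ ()
v₀    ≟ v₁    = no λ ()

allVert : (n : ℕ) → List (Vert n)
allVert n = v₀ ∷ v₁ ∷ map old (allFin n)

∈-allVert : ∀ {n} (v : Vert n) → v ∈ allVert n
∈-allVert (old a) = there (there (∈-map⁺ old (∈-allFin a)))
∈-allVert v₁      = there (here refl)
∈-allVert v₀      = here refl

module FollowAssignment {n : ℕ} (adj : Fin n → Fin n → Bool) (side : Fin n → Bool)
                        (R : Vert n → Bool) (σ : Vert n → Maybe (Vert n))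
                        (assignment : IsAssignment adj side R σ) where
  open IsAssignment assignment
  open Unvisited _≟_ (allVert n)

  -- The default v₁ is never played: the responder always answers a matched vertex.
  follow : Strategy n
  follow []      = v₁
  follow (p ∷ _) = fromMaybe v₁ (σ p)

  Covered : List (Vert n) → Set
  Covered P = ∀ {x} → x ∈ P → σ x ≡ nothing → x ≡ v₀ ⊎ ∃[ y ] y ∈ P × σ y ≡ just x

  play-follow : ∀ {i P w u} → σ w ≡ just u → toMove (w ∷ P) ≡ i →
                LegalMove adj side (w ∷ P) u → Wins adj side i follow (u ∷ w ∷ P) →
                Wins adj side i follow (w ∷ P)
  play-follow σw≡u with refl ← cong (fromMaybe v₁) σw≡u = myTurn

  reply-∉ : ∀ {Q w u} → Covered Q → w ∉ Q → σ w ≡ just u → σ u ≡ nothing → R u ≡ true →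
            u ∉ w ∷ Q
  reply-∉ _ _ σw≡u σu≡nothing _ (here refl) with () ← trans (sym σw≡u) σu≡nothing
  reply-∉ {Q} {w} cov w∉Q σw≡u σu≡nothing Ru (there u∈Q) with cov u∈Q σu≡nothing
  ... | inj₁ refl             = C3₀ w σw≡u
  ... | inj₂ (y , y∈Q , σy≡u) = w∉Q (subst (_∈ Q) (C3 _ Ru y w σy≡u σw≡u) y∈Q)

  Covered-reply : ∀ {Q w u} → Covered Q → σ w ≡ just u → Covered (u ∷ w ∷ Q)
  Covered-reply {w = w} _ σw≡u (here refl) _ = inj₂ (w , there (here refl) , σw≡u)
  Covered-reply _ σw≡u (there (here refl)) σw≡nothing with () ← trans (sym σw≡u) σw≡nothing
  Covered-reply cov _ (there (there x∈Q)) σx≡nothing =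
    Sum.map₂ (λ (y , y∈Q , σy≡x) → y , there (there y∈Q) , σy≡x) (cov x∈Q σx≡nothing)

  follow-wins : ∀ i {p P} → Acc _<_ (length (unvisited (p ∷ P))) →
                toMove (p ∷ P) ≡ other i → R p ≡ true → σ p ≡ nothing →
                Covered (p ∷ P) → Wins adj side i follow (p ∷ P)
  follow-wins i {p} {P} (acc smaller) opponent-turn Rp σp≡nothing cov =
    oppTurn opponent-turn answer
    where
    answer : ∀ w → LegalMove adj side (p ∷ P) w → Wins adj side i follow (w ∷ p ∷ P)
    answer w (p~w , w∉) with C2 p Rp σp≡nothing w p~w
    ... | Rw , σw≢nothing with u , σw≡u ← ≢nothing⇒just σw≢nothing
                          with w~u , Ru , σu≡nothing ← C1 w u Rw σw≡u =
      play-follow σw≡u my-turn (w~u , u∉)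
        (follow-wins i (smaller (<-trans (unvisited-∷-< (∈-allVert u) u∉)
                                         (unvisited-∷-< (∈-allVert w) w∉)))
                     (cong other my-turn) Ru σu≡nothing (Covered-reply cov σw≡u))
      where
      my-turn : toMove (w ∷ p ∷ P) ≡ i
      my-turn = trans (cong other opponent-turn) (other-involutive i)
      u∉ : u ∉ w ∷ p ∷ P
      u∉ = reply-∉ cov w∉ σw≡u σu≡nothing Ru

  follow-wins-from : ∀ i {p P} → toMove (p ∷ P) ≡ other i → R p ≡ true → σ p ≡ nothing →
                     Covered (p ∷ P) → Wins adj side i follow (p ∷ P)
  follow-wins-from i = follow-wins i (<-wellFounded _)

  player1-wins : σ v₀ ≢ nothing → HasWinningStrategy adj side player1
  player1-wins σv₀≢nothing with u , σv₀≡u ← ≢nothing⇒just σv₀≢nothing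
                           with v₀~u , Ru , σu≡nothing ← C1 v₀ u v₀∈R σv₀≡u =
    follow , play-follow σv₀≡u refl (v₀~u , λ { (here refl) → v₀~u })
               (follow-wins-from player1 refl Ru σu≡nothing covered)
    where
    covered : Covered (u ∷ v₀ ∷ [])
    covered (here refl)         _ = inj₂ (v₀ , there (here refl) , σv₀≡u)
    covered (there (here refl)) _ = inj₁ refl

  player2-wins : σ v₀ ≡ nothing → HasWinningStrategy adj side player2
  player2-wins σv₀≡nothing =
    follow , follow-wins-from player2 refl v₀∈R σv₀≡nothing λ { (here refl) _ → inj₁ refl }

proposition1 : (n : ℕ) (adj : Fin n → Fin n → Bool) (side : Fin n → Bool) →
    IsSimple adj → IsBipartition adj side →
    (R : Vert n → Bool) (σ : Vert n → Maybe (Vert n)) →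
    IsAssignment adj side R σ →
    (σ v₀ ≢ nothing → HasWinningStrategy adj side player1) ×
    (σ v₀ ≡ nothing → HasWinningStrategy adj side player2)
proposition1 n adj side _ _ R σ assignment = player1-wins , player2-wins
  where open FollowAssignment adj side R σ assignment
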